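{- Let $\mathcal{T}$ be a finite binary tree (each node has 0, 1 or 2 children) in which each node $v$ carries a weight $w(v)\ge0$ (a real number) such that: (a) if $v$ is a leaf then $w(v)\le1$; (b) if $v$ has two children $v_1,v_2$ then $w(v)\le w(v_1)+w(v_2)$; (c) if $v$ has exactly one child $v_1$ then $w(v)\le w(v_1)+2$. Then the number of nodes $|\mathcal{T}|$ of $\mathcal{T}$ satisfies $|\mathcal{T}|\ge\tfrac12 w(r)$, where $r$ is the root of $\mathcal{T}$. -}

module Defs where

open import Level using (Level; _⊔_) renaming (suc to lsuc)
open import Data.Nat using (ℕ; zero; suc) renaming (_+_ to _+ℕ_)
open import Data.Product using (_×_)
open import Algebra.Bundles using (CommutativeRing)
open import Relation.Binary.Core using (Rel)
open import Relation.Binary.Structures using (IsTotalOrder)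
open import Relation.Nullary using (¬_)

-- A totally ordered commutative ring (the standard axioms; ℝ is an instance).
-- agda-stdlib has no real numbers, so the weights live in an arbitrary such ring.
record OrderedCommutativeRing (c ℓ₁ ℓ₂ : Level) : Set (lsuc (c ⊔ ℓ₁ ⊔ ℓ₂)) where
  field
    commutativeRing : CommutativeRing c ℓ₁
  open CommutativeRing commutativeRing public
  field
    _≤_          : Rel Carrier ℓ₂
    isTotalOrder : IsTotalOrder _≈_ _≤_
    +-monoʳ-≤    : ∀ {a b} (x : Carrier) → a ≤ b → (a + x) ≤ (b + x)
    *-nonneg     : ∀ {a b} → 0# ≤ a → 0# ≤ b → 0# ≤ (a * b)
    nontrivial   : ¬ (1# ≈ 0#)

  fromℕ : ℕ → Carrier
  fromℕ zero    = 0#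
  fromℕ (suc n) = 1# + fromℕ n

data WTree {a} (A : Set a) : Set a where
  node0 : (w : A) → WTree A
  node1 : (w : A) → (child : WTree A) → WTree A
  node2 : (w : A) → (left right : WTree A) → WTree A

rootWeight : ∀ {a} {A : Set a} → WTree A → A
rootWeight (node0 w)     = w
rootWeight (node1 w _)   = w
rootWeight (node2 w _ _) = w

size : ∀ {a} {A : Set a} → WTree A → ℕ
size (node0 _)     = 1
size (node1 _ t)   = suc (size t)
size (node2 _ l r) = suc (size l +ℕ size r)

module _ {c ℓ₁ ℓ₂} (R : OrderedCommutativeRing c ℓ₁ ℓ₂) where
  open OrderedCommutativeRing R

  Admissible : WTree Carrier → Set (ℓ₂)
  Admissible (node0 w)     = (0# ≤ w) × (w ≤ 1#)
  Admissible (node1 w t)   = (0# ≤ w) × (w ≤ (rootWeight t + (1# + 1#))) × Admissible t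
  Admissible (node2 w l r) = (0# ≤ w) × (w ≤ (rootWeight l + rootWeight r))
                             × Admissible l × Admissible r

-- Induction on the tree: a leaf has weight ≤ 1 ≤ 2; a unary node adds one node and at most 2 to
-- the weight; a binary node adds one node while its weight is at most the sum of its children's.
module Submission where

open import Defs
open import Data.Nat as ℕ using (ℕ; zero; suc; _*_)
open import Data.Nat.Properties using (*-suc; *-distribˡ-+)
open import Data.Product using (_,_)
open import Data.Sum using (inj₁; inj₂)
open import Relation.Binary.Bundles using (Preorder)
open import Relation.Binary.Structures using (IsTotalOrder)
open import Relation.Binary.PropositionalEquality using (_≡_; cong)
import Relation.Binary.Reasoning.Preorder as PreorderReasoning
import Algebra.Properties.Ring as RingProperties

module OrderedCommutativeRingProperties {c ℓ₁ ℓ₂} (R : OrderedCommutativeRing c ℓ₁ ℓ₂) where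
  open OrderedCommutativeRing R renaming (_*_ to _·_)
  open IsTotalOrder isTotalOrder using (total; isPreorder; ≤-respʳ-≈)
    renaming (trans to ≤-trans; reflexive to ≤-reflexive)
  open RingProperties ring using (-1*x≈-x; -‿involutive)

  ≤-preorder : Preorder c ℓ₁ ℓ₂
  ≤-preorder = record { isPreorder = isPreorder }

  open PreorderReasoning ≤-preorder public

  +-monoˡ-≤ : ∀ {a b} (x : Carrier) → a ≤ b → (x + a) ≤ (x + b)
  +-monoˡ-≤ {a} {b} x a≤b = begin
    x + a  ≈⟨ +-comm x a ⟩
    a + x  ∼⟨ +-monoʳ-≤ x a≤b ⟩
    b + x  ≈⟨ +-comm b x ⟩
    x + b  ∎

  +-mono-≤ : ∀ {a b x y} → a ≤ b → x ≤ y → (a + x) ≤ (b + y)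
  +-mono-≤ {b = b} {x = x} a≤b x≤y = ≤-trans (+-monoʳ-≤ x a≤b) (+-monoˡ-≤ b x≤y)

  x≤y+x : ∀ {x y} → 0# ≤ y → x ≤ (y + x)
  x≤y+x {x} {y} 0≤y = begin
    x       ≈⟨ sym (+-identityˡ x) ⟩
    0# + x  ∼⟨ +-monoʳ-≤ x 0≤y ⟩
    y + x   ∎

  -- If 1 ≤ 0 then 0 ≤ -1, and 1 = (-1)(-1) is a product of nonnegatives.
  0≤1 : 0# ≤ 1#
  0≤1 with total 0# 1#
  ... | inj₁ 0≤1 = 0≤1
  ... | inj₂ 1≤0 = begin
    0#               ∼⟨ *-nonneg 0≤-1 0≤-1 ⟩
    - 1# · - 1#      ≈⟨ -1*x≈-x (- 1#) ⟩
    - (- 1#)         ≈⟨ -‿involutive 1# ⟩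
    1#               ∎
    where
      0≤-1 : 0# ≤ (- 1#)
      0≤-1 = begin
        0#           ≈⟨ sym (-‿inverseʳ 1#) ⟩
        1# + - 1#    ∼⟨ +-monoʳ-≤ (- 1#) 1≤0 ⟩
        0# + - 1#    ≈⟨ +-identityˡ (- 1#) ⟩
        - 1#         ∎

  fromℕ-cong : ∀ {m n} → m ≡ n → fromℕ m ≈ fromℕ n
  fromℕ-cong m≡n = reflexive (cong fromℕ m≡n)

  fromℕ-+ : ∀ m n → fromℕ (m ℕ.+ n) ≈ fromℕ m + fromℕ n
  fromℕ-+ zero    n = sym (+-identityˡ (fromℕ n))
  fromℕ-+ (suc m) n = trans (+-congˡ (fromℕ-+ m n)) (sym (+-assoc 1# (fromℕ m) (fromℕ n)))

  0≤fromℕ : ∀ n → 0# ≤ fromℕ n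
  0≤fromℕ zero    = ≤-reflexive refl
  0≤fromℕ (suc n) = ≤-trans (0≤fromℕ n) (x≤y+x 0≤1)

  fromℕ-2 : fromℕ 2 ≈ 1# + 1#
  fromℕ-2 = +-congˡ (+-identityʳ 1#)

  0≤2 : 0# ≤ (1# + 1#)
  0≤2 = ≤-respʳ-≈ fromℕ-2 (0≤fromℕ 2)

  fromℕ-2*suc : ∀ n → fromℕ (2 * suc n) ≈ (1# + 1#) + fromℕ (2 * n)
  fromℕ-2*suc n = begin-equality
    fromℕ (2 * suc n)             ≈⟨ fromℕ-cong (*-suc 2 n) ⟩
    fromℕ (2 ℕ.+ 2 * n)           ≈⟨ fromℕ-+ 2 (2 * n) ⟩
    fromℕ 2 + fromℕ (2 * n)       ≈⟨ +-congʳ fromℕ-2 ⟩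
    (1# + 1#) + fromℕ (2 * n)     ∎

  fromℕ-2*+ : ∀ m n → fromℕ (2 * (m ℕ.+ n)) ≈ fromℕ (2 * m) + fromℕ (2 * n)
  fromℕ-2*+ m n = trans (fromℕ-cong (*-distribˡ-+ 2 m n)) (fromℕ-+ (2 * m) (2 * n))

module _ {c ℓ₁ ℓ₂} (R : OrderedCommutativeRing c ℓ₁ ℓ₂) where
  open OrderedCommutativeRing R hiding (_*_)
  open OrderedCommutativeRingProperties R

  rootWeight≤2*size : ∀ T → Admissible R T → rootWeight T ≤ fromℕ (2 * size T)
  rootWeight≤2*size (node0 w) (_ , w≤1) = begin
    w               ∼⟨ w≤1 ⟩
    1#              ≈⟨ sym (+-identityʳ 1#) ⟩
    1# + 0#         ∼⟨ +-monoˡ-≤ 1# (0≤fromℕ 1) ⟩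
    1# + fromℕ 1    ∎
  rootWeight≤2*size (node1 w t) (_ , w≤t+2 , adm-t) = begin
    w                             ∼⟨ w≤t+2 ⟩
    rootWeight t + (1# + 1#)      ≈⟨ +-comm (rootWeight t) (1# + 1#) ⟩
    (1# + 1#) + rootWeight t      ∼⟨ +-monoˡ-≤ (1# + 1#) (rootWeight≤2*size t adm-t) ⟩
    (1# + 1#) + fromℕ (2 * size t) ≈⟨ sym (fromℕ-2*suc (size t)) ⟩
    fromℕ (2 * suc (size t))      ∎
  rootWeight≤2*size (node2 w l r) (_ , w≤l+r , adm-l , adm-r) = begin
    w                                          ∼⟨ w≤l+r ⟩
    rootWeight l + rootWeight r                ∼⟨ +-mono-≤ (rootWeight≤2*size l adm-l)
                                                           (rootWeight≤2*size r adm-r) ⟩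
    fromℕ (2 * size l) + fromℕ (2 * size r)    ≈⟨ sym (fromℕ-2*+ (size l) (size r)) ⟩
    fromℕ (2 * n)                              ∼⟨ x≤y+x 0≤2 ⟩
    (1# + 1#) + fromℕ (2 * n)                  ≈⟨ sym (fromℕ-2*suc n) ⟩
    fromℕ (2 * suc n)                          ∎
    where n = size l ℕ.+ size r

lemma3p10 : ∀ {c ℓ₁ ℓ₂} (R : OrderedCommutativeRing c ℓ₁ ℓ₂) (T : WTree (OrderedCommutativeRing.Carrier R))
    → Admissible R T
    → OrderedCommutativeRing._≤_ R (rootWeight T) (OrderedCommutativeRing.fromℕ R (2 * size T))
lemma3p10 R T = rootWeight≤2*size R T
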